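{- There exists a unique unital algebra homomorphism $\natural:\mathcal H\to U(\mathfrak{sl}_2)\otimes U(\mathfrak{sl}_2)$ that sends $$A\mapsto \frac{H\otimes 1-1\otimes H}{4},\qquad B\mapsto \frac{\Delta(\Lambda)}{2},\qquad C\mapsto E\otimes F-F\otimes E.$$ Moreover $\natural$ sends $$\alpha\mapsto \frac{\Lambda\otimes 1+1\otimes \Lambda}{2}+\frac{\Delta(H)^2}{8},\qquad \beta\mapsto \frac{(\Lambda\otimes 1-1\otimes \Lambda)\Delta(H)}{2}.$$
   Context: All algebras are unital associative algebras over $\mathbb C$; $[x,y]=xy-yx$; $\otimes$ is over $\mathbb C$. $U(\mathfrak{sl}_2)$ is the algebra generated by $E,F,H$ with relations $[H,E]=2E$, $[H,F]=-2F$, $[E,F]=H$. Its Casimir element is $\Lambda=EF+FE+\frac{H^2}{2}$. The comultiplication $\Delta:U(\mathfrak{sl}_2)\to U(\mathfrak{sl}_2)\otimes U(\mathfrak{sl}_2)$ is the algebra homomorphism with $\Delta(X)=X\otimes 1+1\otimes X$ for $X\in\{E,F,H\}$. The universal Hahn algebra $\mathcal H$ is the algebra generated by $A,B,C$ subject to the relations $[A,B]=C$ and that each of $\alpha:=[C,A]+2A^2+B$ and $\beta:=[B,C]+4BA+2C$ is central in $\mathcal H$. -}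

module Defs where

open import Level using (_⊔_)
open import Algebra.Bundles using (CommutativeRing)
open import Function using (_∘_)

data HGen : Set where
  A B C : HGen

data SlGen : Set where
  E F H : SlGen

-- Generators of U(sl2) ⊗ U(sl2):  L x  stands for  x ⊗ 1,  R x  for  1 ⊗ x.
data TGen : Set where
  L R : SlGen → TGen

-- Everything is over a commutative ring K of scalars, together with an
-- element half (the statement assumes half + half ≈ 1, i.e. half = 1/2).
module Alg {c ℓ} (K : CommutativeRing c ℓ) (half : CommutativeRing.Carrier K) where
  open CommutativeRing K using () renaming
    (Carrier to S; _≈_ to _≈ₛ_; _+_ to _+ₛ_; _*_ to _*ₛ_; -_ to -ₛ_; 0# to 0ₛ; 1# to 1ₛ)

  infixl 6 _⊕_
  infixl 7 _⊛_
  infix 4 _∼_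

  data Tm (X : Set) : Set c where
    gen : X → Tm X
    sc  : S → Tm X                 -- the scalar k·1
    _⊕_ : Tm X → Tm X → Tm X
    _⊛_ : Tm X → Tm X → Tm X

  module _ {X : Set} where
    infixl 6 _⊖_
    infixl 7 _·_
    _·_ : S → Tm X → Tm X
    k · t = sc k ⊛ t

    _⊖_ : Tm X → Tm X → Tm X
    s ⊖ t = s ⊕ (-ₛ 1ₛ) · t

    [_,_] : Tm X → Tm X → Tm X
    [ s , t ] = s ⊛ t ⊖ t ⊛ s

  subst : {X Y : Set} → (X → Tm Y) → Tm X → Tm Y
  subst σ (gen x) = σ x
  subst σ (sc k)  = sc k
  subst σ (s ⊕ t) = subst σ s ⊕ subst σ t
  subst σ (s ⊛ t) = subst σ s ⊛ subst σ t

  -- Tm X / Eq Rl is the K-algebra presented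
  -- by generators X and relations Rl (free algebra modulo the two-sided ideal).
  data Eq {X : Set} (Rl : Tm X → Tm X → Set c) : Tm X → Tm X → Set (c ⊔ ℓ) where
    rel     : ∀ {s t} → Rl s t → Eq Rl s t
    refl    : ∀ {s} → Eq Rl s s
    sym     : ∀ {s t} → Eq Rl s t → Eq Rl t s
    trans   : ∀ {s t u} → Eq Rl s t → Eq Rl t u → Eq Rl s u
    ⊕-cong  : ∀ {s s' t t'} → Eq Rl s s' → Eq Rl t t' → Eq Rl (s ⊕ t) (s' ⊕ t')
    ⊛-cong  : ∀ {s s' t t'} → Eq Rl s s' → Eq Rl t t' → Eq Rl (s ⊛ t) (s' ⊛ t')
    sc-cong : ∀ {a b} → a ≈ₛ b → Eq Rl (sc a) (sc b)
    ⊕-assoc : ∀ s t u → Eq Rl ((s ⊕ t) ⊕ u) (s ⊕ (t ⊕ u))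
    ⊕-comm  : ∀ s t → Eq Rl (s ⊕ t) (t ⊕ s)
    ⊕-idˡ   : ∀ s → Eq Rl (sc 0ₛ ⊕ s) s
    ⊕-invˡ  : ∀ s → Eq Rl ((-ₛ 1ₛ) · s ⊕ s) (sc 0ₛ)
    ⊛-assoc : ∀ s t u → Eq Rl ((s ⊛ t) ⊛ u) (s ⊛ (t ⊛ u))
    ⊛-idˡ   : ∀ s → Eq Rl (sc 1ₛ ⊛ s) s
    ⊛-idʳ   : ∀ s → Eq Rl (s ⊛ sc 1ₛ) s
    distribˡ : ∀ s t u → Eq Rl (s ⊛ (t ⊕ u)) (s ⊛ t ⊕ s ⊛ u)
    distribʳ : ∀ s t u → Eq Rl ((t ⊕ u) ⊛ s) (t ⊛ s ⊕ u ⊛ s)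
    sc-+    : ∀ a b → Eq Rl (sc (a +ₛ b)) (sc a ⊕ sc b)
    sc-*    : ∀ a b → Eq Rl (sc (a *ₛ b)) (sc a ⊛ sc b)
    sc-central : ∀ a s → Eq Rl (sc a ⊛ s) (s ⊛ sc a)

  -- A (unital, K-linear) algebra homomorphism between presented algebras,
  -- given by its action on representatives.
  record IsHom {X Y : Set} (RX : Tm X → Tm X → Set c) (RY : Tm Y → Tm Y → Set c)
               (f : Tm X → Tm Y) : Set (c ⊔ ℓ) where
    field
      resp   : ∀ {s t} → Eq RX s t → Eq RY (f s) (f t)
      pres-⊕ : ∀ s t → Eq RY (f (s ⊕ t)) (f s ⊕ f t)
      pres-⊛ : ∀ s t → Eq RY (f (s ⊛ t)) (f s ⊛ f t)
      pres-sc : ∀ k → Eq RY (f (sc k)) (sc k)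

  two four : S
  two = 1ₛ +ₛ 1ₛ
  four = two +ₛ two

  quarter eighth : S
  quarter = half *ₛ half
  eighth = quarter *ₛ half

  data SlRel : Tm SlGen → Tm SlGen → Set c where
    HE : SlRel [ gen H , gen E ] (two · gen E)
    HF : SlRel [ gen H , gen F ] ((-ₛ two) · gen F)
    EF : SlRel [ gen E , gen F ] (gen H)

  Λ : Tm SlGen
  Λ = gen E ⊛ gen F ⊕ gen F ⊛ gen E ⊕ half · (gen H ⊛ gen H)

  _⊗1 : Tm SlGen → Tm TGen
  _⊗1 = subst (gen ∘ L)

  1⊗_ : Tm SlGen → Tm TGen
  1⊗_ = subst (gen ∘ R)

  data TRel : Tm TGen → Tm TGen → Set c where
    left  : ∀ {s t} → SlRel s t → TRel (s ⊗1) (t ⊗1)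
    right : ∀ {s t} → SlRel s t → TRel (1⊗ s) (1⊗ t)
    comm  : ∀ x y → TRel [ gen (L x) , gen (R y) ] (sc 0ₛ)

  Δ : Tm SlGen → Tm TGen
  Δ = subst (λ x → gen (L x) ⊕ gen (R x))

  α β : Tm HGen
  α = [ gen C , gen A ] ⊕ two · (gen A ⊛ gen A) ⊕ gen B
  β = [ gen B , gen C ] ⊕ four · (gen B ⊛ gen A) ⊕ two · gen C

  data HRel : Tm HGen → Tm HGen → Set c where
    AB : HRel [ gen A , gen B ] (gen C)
    α-central : ∀ x → HRel [ α , gen x ] (sc 0ₛ)
    β-central : ∀ x → HRel [ β , gen x ] (sc 0ₛ)

  _∼_ : Tm TGen → Tm TGen → Set (c ⊔ ℓ)
  _∼_ = Eq TRel

  ♮A ♮B ♮C ♮α ♮β : Tm TGen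
  ♮A = quarter · (gen H ⊗1 ⊖ 1⊗ gen H)
  ♮B = half · Δ Λ
  ♮C = gen E ⊗1 ⊛ 1⊗ gen F ⊖ gen F ⊗1 ⊛ 1⊗ gen E
  ♮α = half · (Λ ⊗1 ⊕ 1⊗ Λ) ⊕ eighth · (Δ (gen H) ⊛ Δ (gen H))
  ♮β = half · ((Λ ⊗1 ⊖ 1⊗ Λ) ⊛ Δ (gen H))

-- ♮ is forced to be the substitution A, B, C ↦ ♮A, ♮B, ♮C, since A, B, C generate ℋ; it is well
-- defined as soon as these images satisfy the defining relations of ℋ, i.e. [♮A, ♮B] = ♮C and the images
-- of α and β commute with ♮A, ♮B, ♮C.  These, and the formulas for the images of α and β, are identities
-- in U(sl₂) ⊗ U(sl₂), each checked by rewriting both sides to PBW normal form with the commutation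
-- relations: words sorted as E < F < H with the left factor first, and coefficients in ℤ[1/2], where
-- equality is decidable.
module Submission where

open import Defs
open import Level using (_⊔_)
open import Algebra.Bundles using (CommutativeRing; Ring)
import Algebra.Properties.Ring as RingProperties
import Algebra.Properties.Semiring.Mult as SemiringMult
import Algebra.Properties.Semiring.Exp as SemiringExp
open import Algebra.Solver.Ring.AlmostCommutativeRing using (fromCommutativeRing; -raw-almostCommutative⟶)
import Algebra.Solver.Ring as RingSolver
open import Data.List using (List; []; _∷_; _++_; map; concatMap; foldr)
import Data.List.Properties as List
open import Data.List.Relation.Unary.All using (All; []; _∷_; all?)
open import Data.Maybe using (Maybe; just; nothing)
open import Data.Nat as ℕ using (ℕ; zero; suc)
import Data.Nat.Properties as ℕ
open import Data.Product using (Σ; _×_; _,_)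
open import Function using (_∘_)
open import Relation.Binary.Definitions using (DecidableEquality)
open import Relation.Binary.PropositionalEquality as ≡ using (_≡_)
import Relation.Binary.Reasoning.Setoid as SetoidReasoning
open import Relation.Nullary using (yes; no)
open import Relation.Nullary.Decidable using (True; toWitness; map′)
open import Relation.Unary using (Decidable)

module Expressions {c ℓ} (K : CommutativeRing c ℓ) (half : CommutativeRing.Carrier K) where
  open CommutativeRing K using (Carrier; 0#; 1#; _+_; _*_; -_)
  open Alg K half using (Tm; gen; sc; _⊕_; _⊛_; Eq)

  infixl 6 _+ˢ_ _⊕ᴱ_
  infixl 7 _*ˢ_ _⊛ᴱ_
  infix 8 -ˢ_

  data ScalarExpr : Set where
    0ˢ 1ˢ ½ˢ  : ScalarExpr
    -ˢ_       : ScalarExpr → ScalarExpr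
    _+ˢ_ _*ˢ_ : ScalarExpr → ScalarExpr → ScalarExpr

  ⟦_⟧ˢ : ScalarExpr → Carrier
  ⟦ 0ˢ ⟧ˢ     = 0#
  ⟦ 1ˢ ⟧ˢ     = 1#
  ⟦ ½ˢ ⟧ˢ     = half
  ⟦ -ˢ e ⟧ˢ   = - ⟦ e ⟧ˢ
  ⟦ e +ˢ f ⟧ˢ = ⟦ e ⟧ˢ + ⟦ f ⟧ˢ
  ⟦ e *ˢ f ⟧ˢ = ⟦ e ⟧ˢ * ⟦ f ⟧ˢ

  data Expr (X : Set) : Set where
    var       : X → Expr X
    con       : ScalarExpr → Expr X
    _⊕ᴱ_ _⊛ᴱ_ : Expr X → Expr X → Expr X

  ⟦_⟧ᴱ : ∀ {X} → Expr X → Tm X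
  ⟦ var x ⟧ᴱ  = gen x
  ⟦ con e ⟧ᴱ  = sc ⟦ e ⟧ˢ
  ⟦ s ⊕ᴱ t ⟧ᴱ = ⟦ s ⟧ᴱ ⊕ ⟦ t ⟧ᴱ
  ⟦ s ⊛ᴱ t ⟧ᴱ = ⟦ s ⟧ᴱ ⊛ ⟦ t ⟧ᴱ

  module _ {X : Set} where
    infixl 6 _⊖ᴱ_
    infixl 7 _·ᴱ_

    _·ᴱ_ : ScalarExpr → Expr X → Expr X
    e ·ᴱ t = con e ⊛ᴱ t

    _⊖ᴱ_ : Expr X → Expr X → Expr X
    s ⊖ᴱ t = s ⊕ᴱ (-ˢ 1ˢ) ·ᴱ t

    [_,_]ᴱ : Expr X → Expr X → Expr X
    [ s , t ]ᴱ = s ⊛ᴱ t ⊖ᴱ t ⊛ᴱ s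

    Commutation : (Tm X → Tm X → Set c) → X → X → Set (c ⊔ ℓ)
    Commutation Rl x y = Σ (Expr X) λ q → Eq Rl (gen x ⊛ gen y) (gen y ⊛ gen x ⊕ ⟦ q ⟧ᴱ)

  substᴱ : {X Y : Set} → (X → Expr Y) → Expr X → Expr Y
  substᴱ σ (var x)  = σ x
  substᴱ σ (con e)  = con e
  substᴱ σ (s ⊕ᴱ t) = substᴱ σ s ⊕ᴱ substᴱ σ t
  substᴱ σ (s ⊛ᴱ t) = substᴱ σ s ⊛ᴱ substᴱ σ t

module Dyadics {c ℓ} (K : CommutativeRing c ℓ) (half : CommutativeRing.Carrier K)
  (half+half≈1 : CommutativeRing._≈_ K (CommutativeRing._+_ K half half) (CommutativeRing.1# K)) where

  open CommutativeRing K
  open Expressions K half using (ScalarExpr; 0ˢ; 1ˢ; ½ˢ; -ˢ_; _+ˢ_; _*ˢ_; ⟦_⟧ˢ)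
  open SetoidReasoning setoid
  open SemiringMult semiring using (×-homo-+; ×1-homo-*) renaming (_×_ to _×ᴷ_)
  open RingProperties ring using (-0#≈0#; -‿distribˡ-*; ⁻¹-anti-homo‿-; [y-z]x≈yx-zx; x[y-z]≈xy-xz)
  open SemiringExp semiring using (_^_; ^-homo-*)
  open RingSolver rawRing (fromCommutativeRing K) (-raw-almostCommutative⟶ _) (λ _ _ → nothing)
    using (solve; _:=_; _:+_; _:*_; _:-_)

  infixl 6 _+ᵈ_
  infixl 7 _*ᵈ_

  ι : ℕ → Carrier
  ι n = n ×ᴷ 1#

  -- The integer numerator is represented as pos - neg.
  record Dyadic : Set where
    constructor dyadic
    field pos neg exp : ℕ

  open Dyadic

  ⟦_⟧ᵈ : Dyadic → Carrier
  ⟦ dyadic p n k ⟧ᵈ = (ι p - ι n) * half ^ k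

  0ᵈ 1ᵈ ½ᵈ : Dyadic
  0ᵈ = dyadic 0 0 0
  1ᵈ = dyadic 1 0 0
  ½ᵈ = dyadic 1 0 1

  -ᵈ_ : Dyadic → Dyadic
  -ᵈ dyadic p n k = dyadic n p k

  raise : ℕ → Dyadic → Dyadic
  raise m (dyadic p n k) = dyadic (p ℕ.* 2 ℕ.^ (m ℕ.∸ k)) (n ℕ.* 2 ℕ.^ (m ℕ.∸ k)) m

  addNumerators : Dyadic → Dyadic → Dyadic
  addNumerators (dyadic p n k) (dyadic p' n' _) = dyadic (p ℕ.+ p') (n ℕ.+ n') k

  _+ᵈ_ : Dyadic → Dyadic → Dyadic
  d +ᵈ e = addNumerators (raise m d) (raise m e)
    where m = exp d ℕ.⊔ exp e

  _*ᵈ_ : Dyadic → Dyadic → Dyadic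
  dyadic p n k *ᵈ dyadic p' n' k' = dyadic (p ℕ.* p' ℕ.+ n ℕ.* n') (p ℕ.* n' ℕ.+ n ℕ.* p') (k ℕ.+ k')

  ι-+ : ∀ m n → ι (m ℕ.+ n) ≈ ι m + ι n
  ι-+ = ×-homo-+ 1#

  ι2^k*half^k≈1 : ∀ k → ι (2 ℕ.^ k) * half ^ k ≈ 1#
  ι2^k*half^k≈1 zero = trans (*-identityʳ _) (+-identityʳ _)
  ι2^k*half^k≈1 (suc k) = begin
    ι (2 ℕ.* 2 ℕ.^ k) * (half * half ^ k)      ≈⟨ *-congʳ (×1-homo-* 2 (2 ℕ.^ k)) ⟩
    ι 2 * ι (2 ℕ.^ k) * (half * half ^ k)      ≈⟨ solve 4 (λ t u h v → t :* u :* (h :* v) := t :* h :* (u :* v)) refl (ι 2) (ι (2 ℕ.^ k)) half (half ^ k) ⟩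
    ι 2 * half * (ι (2 ℕ.^ k) * half ^ k)      ≈⟨ *-cong ι2*half≈1 (ι2^k*half^k≈1 k) ⟩
    1# * 1#                                      ≈⟨ *-identityʳ 1# ⟩
    1# ∎
    where
    ι2*half≈1 : ι 2 * half ≈ 1#
    ι2*half≈1 = begin
      (1# + (1# + 0#)) * half   ≈⟨ *-congʳ (+-congˡ (+-identityʳ 1#)) ⟩
      (1# + 1#) * half          ≈⟨ distribʳ half 1# 1# ⟩
      1# * half + 1# * half     ≈⟨ +-cong (*-identityˡ half) (*-identityˡ half) ⟩
      half + half               ≈⟨ half+half≈1 ⟩
      1# ∎

  ⟦⟧ᵈ-raise : ∀ {m} d → exp d ℕ.≤ m → ⟦ raise m d ⟧ᵈ ≈ ⟦ d ⟧ᵈ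
  ⟦⟧ᵈ-raise {m} (dyadic p n k) k≤m with m ℕ.∸ k | ℕ.m+[n∸m]≡n k≤m
  ... | j | ≡.refl = begin
    (ι (p ℕ.* 2 ℕ.^ j) - ι (n ℕ.* 2 ℕ.^ j)) * half ^ (k ℕ.+ j)
      ≈⟨ *-cong (+-cong (×1-homo-* p _) (-‿cong (×1-homo-* n _))) (^-homo-* half k j) ⟩
    (ι p * ι (2 ℕ.^ j) - ι n * ι (2 ℕ.^ j)) * (half ^ k * half ^ j)
      ≈⟨ *-congʳ ([y-z]x≈yx-zx (ι (2 ℕ.^ j)) (ι p) (ι n)) ⟨
    (ι p - ι n) * ι (2 ℕ.^ j) * (half ^ k * half ^ j)
      ≈⟨ solve 4 (λ d t u v → d :* t :* (u :* v) := d :* u :* (t :* v)) refl (ι p - ι n) (ι (2 ℕ.^ j)) (half ^ k) (half ^ j) ⟩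
    (ι p - ι n) * half ^ k * (ι (2 ℕ.^ j) * half ^ j)
      ≈⟨ *-congˡ (ι2^k*half^k≈1 j) ⟩
    (ι p - ι n) * half ^ k * 1#
      ≈⟨ *-identityʳ _ ⟩
    (ι p - ι n) * half ^ k ∎

  ⟦⟧ᵈ-addNumerators : ∀ d e → exp d ≡ exp e → ⟦ addNumerators d e ⟧ᵈ ≈ ⟦ d ⟧ᵈ + ⟦ e ⟧ᵈ
  ⟦⟧ᵈ-addNumerators (dyadic p n k) (dyadic p' n' _) ≡.refl = begin
    (ι (p ℕ.+ p') - ι (n ℕ.+ n')) * half ^ k
      ≈⟨ *-congʳ (+-cong (ι-+ p p') (-‿cong (ι-+ n n'))) ⟩
    (ι p + ι p' - (ι n + ι n')) * half ^ k
      ≈⟨ solve 5 (λ a a' b b' h → (a :+ a' :- (b :+ b')) :* h := (a :- b) :* h :+ (a' :- b') :* h) refl (ι p) (ι p') (ι n) (ι n') (half ^ k) ⟩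
    (ι p - ι n) * half ^ k + (ι p' - ι n') * half ^ k ∎

  ⟦⟧ᵈ-homo-+ : ∀ d e → ⟦ d +ᵈ e ⟧ᵈ ≈ ⟦ d ⟧ᵈ + ⟦ e ⟧ᵈ
  ⟦⟧ᵈ-homo-+ d e =
    trans (⟦⟧ᵈ-addNumerators (raise m d) (raise m e) ≡.refl)
          (+-cong (⟦⟧ᵈ-raise d (ℕ.m≤m⊔n (exp d) (exp e))) (⟦⟧ᵈ-raise e (ℕ.m≤n⊔m (exp d) (exp e))))
    where m = exp d ℕ.⊔ exp e

  *-of-differences : ∀ a b c d → (a - b) * (c - d) ≈ a * c + b * d - (a * d + b * c)
  *-of-differences a b c d = begin
    (a - b) * (c - d)                  ≈⟨ [y-z]x≈yx-zx (c - d) a b ⟩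
    a * (c - d) - b * (c - d)          ≈⟨ +-cong (x[y-z]≈xy-xz a c d) (-‿cong (x[y-z]≈xy-xz b c d)) ⟩
    (a * c - a * d) - (b * c - b * d) ≈⟨ +-congˡ (⁻¹-anti-homo‿- (b * c) (b * d)) ⟩
    (a * c - a * d) + (b * d - b * c) ≈⟨ solve 4 (λ w x y z → w :- x :+ (y :- z) := w :+ y :- (x :+ z)) refl (a * c) (a * d) (b * d) (b * c) ⟩
    a * c + b * d - (a * d + b * c) ∎

  ⟦⟧ᵈ-homo-* : ∀ d e → ⟦ d *ᵈ e ⟧ᵈ ≈ ⟦ d ⟧ᵈ * ⟦ e ⟧ᵈ
  ⟦⟧ᵈ-homo-* (dyadic p n k) (dyadic p' n' k') = begin
    (ι (p ℕ.* p' ℕ.+ n ℕ.* n') - ι (p ℕ.* n' ℕ.+ n ℕ.* p')) * half ^ (k ℕ.+ k')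
      ≈⟨ *-cong (+-cong (ι-+-* p p' n n') (-‿cong (ι-+-* p n' n p'))) (^-homo-* half k k') ⟩
    (ι p * ι p' + ι n * ι n' - (ι p * ι n' + ι n * ι p')) * (half ^ k * half ^ k')
      ≈⟨ *-congʳ (*-of-differences (ι p) (ι n) (ι p') (ι n')) ⟨
    (ι p - ι n) * (ι p' - ι n') * (half ^ k * half ^ k')
      ≈⟨ solve 4 (λ d d' h h' → d :* d' :* (h :* h') := d :* h :* (d' :* h')) refl (ι p - ι n) (ι p' - ι n') (half ^ k) (half ^ k') ⟩
    (ι p - ι n) * half ^ k * ((ι p' - ι n') * half ^ k') ∎
    where
    ι-+-* : ∀ a b c d → ι (a ℕ.* b ℕ.+ c ℕ.* d) ≈ ι a * ι b + ι c * ι d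
    ι-+-* a b c d = trans (ι-+ (a ℕ.* b) (c ℕ.* d)) (+-cong (×1-homo-* a b) (×1-homo-* c d))

  ⟦⟧ᵈ-homo-neg : ∀ d → ⟦ -ᵈ d ⟧ᵈ ≈ - ⟦ d ⟧ᵈ
  ⟦⟧ᵈ-homo-neg (dyadic p n k) = trans (*-congʳ (sym (⁻¹-anti-homo‿- (ι p) (ι n)))) (sym (-‿distribˡ-* _ _))

  ι1-ι0≈1 : ι 1 - ι 0 ≈ 1#
  ι1-ι0≈1 = trans (+-cong (+-identityʳ 1#) -0#≈0#) (+-identityʳ 1#)

  ⟦⟧ᵈ-1 : ⟦ 1ᵈ ⟧ᵈ ≈ 1#
  ⟦⟧ᵈ-1 = trans (*-identityʳ _) ι1-ι0≈1

  ⟦⟧ᵈ-½ : ⟦ ½ᵈ ⟧ᵈ ≈ half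
  ⟦⟧ᵈ-½ = trans (*-cong ι1-ι0≈1 (*-identityʳ half)) (*-identityˡ half)

  ⟦⟧ᵈ-zero : ∀ p k → ⟦ dyadic p p k ⟧ᵈ ≈ 0#
  ⟦⟧ᵈ-zero p k = trans (*-congʳ (-‿inverseʳ (ι p))) (zeroˡ _)

  toDyadic : ScalarExpr → Dyadic
  toDyadic 0ˢ       = 0ᵈ
  toDyadic 1ˢ       = 1ᵈ
  toDyadic ½ˢ       = ½ᵈ
  toDyadic (-ˢ e)   = -ᵈ toDyadic e
  toDyadic (e +ˢ f) = toDyadic e +ᵈ toDyadic f
  toDyadic (e *ˢ f) = toDyadic e *ᵈ toDyadic f

  toDyadic-sound : ∀ e → ⟦ toDyadic e ⟧ᵈ ≈ ⟦ e ⟧ˢ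
  toDyadic-sound 0ˢ       = ⟦⟧ᵈ-zero 0 0
  toDyadic-sound 1ˢ       = ⟦⟧ᵈ-1
  toDyadic-sound ½ˢ       = ⟦⟧ᵈ-½
  toDyadic-sound (-ˢ e)   = trans (⟦⟧ᵈ-homo-neg (toDyadic e)) (-‿cong (toDyadic-sound e))
  toDyadic-sound (e +ˢ f) = trans (⟦⟧ᵈ-homo-+ (toDyadic e) (toDyadic f)) (+-cong (toDyadic-sound e) (toDyadic-sound f))
  toDyadic-sound (e *ˢ f) = trans (⟦⟧ᵈ-homo-* (toDyadic e) (toDyadic f)) (*-cong (toDyadic-sound e) (toDyadic-sound f))

module PresentedRing {c ℓ} (K : CommutativeRing c ℓ) (half : CommutativeRing.Carrier K)
  {X : Set} (Rl : Alg.Tm K half X → Alg.Tm K half X → Set c) where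
  open Alg K half
  open CommutativeRing K using () renaming (0# to 0ₛ; 1# to 1ₛ; -_ to -ₛ_; _*_ to _*ₛ_)

  -- Negation is multiplication by the scalar -1, so that  s ⊖ t  is literally  s - t.
  presentedRing : Ring c (c ⊔ ℓ)
  presentedRing = record
    { Carrier = Tm X ; _≈_ = Eq Rl ; _+_ = _⊕_ ; _*_ = _⊛_ ; -_ = (-ₛ 1ₛ) ·_ ; 0# = sc 0ₛ ; 1# = sc 1ₛ
    ; isRing = record
      { +-isAbelianGroup = record
        { isGroup = record
          { isMonoid = record
            { isSemigroup = record
              { isMagma = record { isEquivalence = record { refl = refl ; sym = sym ; trans = trans } ; ∙-cong = ⊕-cong }
              ; assoc = ⊕-assoc }
            ; identity = ⊕-idˡ , (λ s → trans (⊕-comm s _) (⊕-idˡ s)) }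
          ; inverse = ⊕-invˡ , (λ s → trans (⊕-comm s _) (⊕-invˡ s))
          ; ⁻¹-cong = ⊛-cong refl }
        ; comm = ⊕-comm }
      ; *-cong = ⊛-cong ; *-assoc = ⊛-assoc ; *-identity = ⊛-idˡ , ⊛-idʳ
      ; distrib = distribˡ , (λ s t u → distribʳ s t u) } }

  open Ring presentedRing using (_-_; +-comm; +-congʳ)
  open RingProperties presentedRing using (//-rightDividesˡ; //-rightDividesʳ)
  open SetoidReasoning (Ring.setoid presentedRing)

  sc-commute : ∀ a s t → Eq Rl (sc a ⊛ (s ⊛ t)) (s ⊛ (sc a ⊛ t))
  sc-commute a s t = trans (sym (⊛-assoc _ _ _)) (trans (⊛-cong (sc-central a s) refl) (⊛-assoc _ _ _))

  sc-interchange : ∀ a b s t → Eq Rl ((sc a ⊛ s) ⊛ (sc b ⊛ t)) (sc (a *ₛ b) ⊛ (s ⊛ t))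
  sc-interchange a b s t = begin
    (sc a ⊛ s) ⊛ (sc b ⊛ t) ≈⟨ ⊛-assoc _ _ _ ⟩
    sc a ⊛ (s ⊛ (sc b ⊛ t)) ≈⟨ ⊛-cong refl (sc-commute b s t) ⟨
    sc a ⊛ (sc b ⊛ (s ⊛ t)) ≈⟨ ⊛-assoc _ _ _ ⟨
    (sc a ⊛ sc b) ⊛ (s ⊛ t) ≈⟨ ⊛-cong (sc-* a b) refl ⟨
    sc (a *ₛ b) ⊛ (s ⊛ t)   ∎

  ⊛-swap-by-commutator : ∀ {s t r} → Eq Rl [ s , t ] r → Eq Rl (s ⊛ t) (t ⊛ s ⊕ r)
  ⊛-swap-by-commutator {s} {t} {r} [s,t]≈r = begin
    s ⊛ t                  ≈⟨ //-rightDividesˡ (t ⊛ s) (s ⊛ t) ⟨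
    [ s , t ] ⊕ t ⊛ s      ≈⟨ +-congʳ [s,t]≈r ⟩
    r ⊕ t ⊛ s              ≈⟨ +-comm r (t ⊛ s) ⟩
    t ⊛ s ⊕ r              ∎

  ⊛-swap-by-commutator′ : ∀ {s t r} → Eq Rl [ s , t ] r → Eq Rl (t ⊛ s) (s ⊛ t ⊖ r)
  ⊛-swap-by-commutator′ {s} {t} {r} [s,t]≈r = begin
    t ⊛ s                  ≈⟨ //-rightDividesʳ r (t ⊛ s) ⟨
    (t ⊛ s ⊕ r) ⊖ r        ≈⟨ +-congʳ (⊛-swap-by-commutator [s,t]≈r) ⟨
    s ⊛ t ⊖ r              ∎

  [,]-congˡ : ∀ {s s′} t → Eq Rl s s′ → Eq Rl [ s , t ] [ s′ , t ]
  [,]-congˡ t s≈s′ = ⊕-cong (⊛-cong s≈s′ refl) (⊛-cong refl (⊛-cong refl s≈s′))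

module Substitution {c ℓ} (K : CommutativeRing c ℓ) (half : CommutativeRing.Carrier K)
  {X Y : Set} {RX : Alg.Tm K half X → Alg.Tm K half X → Set c}
  {RY : Alg.Tm K half Y → Alg.Tm K half Y → Set c} (σ : X → Alg.Tm K half Y) where
  open Alg K half

  subst-isHom : (∀ {s t} → RX s t → Eq RY (subst σ s) (subst σ t)) → IsHom RX RY (subst σ)
  subst-isHom respects-relations = record
    { resp = resp ; pres-⊕ = λ _ _ → refl ; pres-⊛ = λ _ _ → refl ; pres-sc = λ _ → refl }
    where
    resp : ∀ {s t} → Eq RX s t → Eq RY (subst σ s) (subst σ t)
    resp (rel r)                = respects-relations r
    resp refl                   = refl
    resp (sym p)                = sym (resp p)
    resp (trans p q)            = trans (resp p) (resp q)
    resp (⊕-cong p q)           = ⊕-cong (resp p) (resp q)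
    resp (⊛-cong p q)           = ⊛-cong (resp p) (resp q)
    resp (sc-cong a≈b)          = sc-cong a≈b
    resp (⊕-assoc _ _ _)        = ⊕-assoc _ _ _
    resp (⊕-comm _ _)           = ⊕-comm _ _
    resp (⊕-idˡ _)              = ⊕-idˡ _
    resp (⊕-invˡ _)             = ⊕-invˡ _
    resp (⊛-assoc _ _ _)        = ⊛-assoc _ _ _
    resp (⊛-idˡ _)              = ⊛-idˡ _
    resp (⊛-idʳ _)              = ⊛-idʳ _
    resp (distribˡ _ _ _)       = distribˡ _ _ _
    resp (distribʳ _ _ _)       = distribʳ _ _ _
    resp (sc-+ a b)             = sc-+ a b
    resp (sc-* a b)             = sc-* a b
    resp (sc-central a _)       = sc-central a _

  subst-unique : ∀ g → IsHom RX RY g → (∀ x → Eq RY (σ x) (g (gen x))) → ∀ t → Eq RY (subst σ t) (g t)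
  subst-unique g g-hom σ≈g (gen x) = σ≈g x
  subst-unique g g-hom σ≈g (sc k)  = sym (IsHom.pres-sc g-hom k)
  subst-unique g g-hom σ≈g (s ⊕ t) =
    trans (⊕-cong (subst-unique g g-hom σ≈g s) (subst-unique g g-hom σ≈g t)) (sym (IsHom.pres-⊕ g-hom s t))
  subst-unique g g-hom σ≈g (s ⊛ t) =
    trans (⊛-cong (subst-unique g g-hom σ≈g s) (subst-unique g g-hom σ≈g t)) (sym (IsHom.pres-⊛ g-hom s t))

module Normalisation {c ℓ} (K : CommutativeRing c ℓ) (half : CommutativeRing.Carrier K)
  (half+half≈1 : CommutativeRing._≈_ K (CommutativeRing._+_ K half half) (CommutativeRing.1# K))
  {X : Set} (_≟_ : DecidableEquality X) (Rl : Alg.Tm K half X → Alg.Tm K half X → Set c)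
  (commute : (x y : X) → Maybe (Expressions.Commutation K half Rl x y)) where
  open Alg K half
  open Expressions K half
  open Dyadics K half half+half≈1 using (Dyadic; dyadic; ⟦_⟧ᵈ; 1ᵈ; _+ᵈ_; _*ᵈ_; toDyadic;
    ⟦⟧ᵈ-1; ⟦⟧ᵈ-homo-+; ⟦⟧ᵈ-homo-*; ⟦⟧ᵈ-zero; toDyadic-sound)
  open CommutativeRing K using () renaming (0# to 0ₛ; 1# to 1ₛ)
  open PresentedRing K half Rl
  open Ring presentedRing using (_≈_; zeroˡ; zeroʳ; +-identityʳ)
  open RingProperties presentedRing using (x∙y⁻¹≈ε⇒x≈y)
  open SetoidReasoning (Ring.setoid presentedRing)

  infixl 7 _*ᵖ_

  Word = List X
  Monomial = Dyadic × Word
  Poly = List Monomial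

  ⟦_⟧ʷ : Word → Tm X
  ⟦ [] ⟧ʷ    = sc 1ₛ
  ⟦ x ∷ w ⟧ʷ = gen x ⊛ ⟦ w ⟧ʷ

  ⟦_⟧ᵐ : Monomial → Tm X
  ⟦ d , w ⟧ᵐ = sc ⟦ d ⟧ᵈ ⊛ ⟦ w ⟧ʷ

  ⟦_⟧ᵖ : Poly → Tm X
  ⟦ [] ⟧ᵖ    = sc 0ₛ
  ⟦ m ∷ p ⟧ᵖ = ⟦ m ⟧ᵐ ⊕ ⟦ p ⟧ᵖ

  monomial : Dyadic → Word → Poly
  monomial d w = (d , w) ∷ []

  _*ᵐ_ : Monomial → Monomial → Monomial
  (d , v) *ᵐ (e , w) = d *ᵈ e , v ++ w

  _*ᵖ_ : Poly → Poly → Poly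
  p *ᵖ q = concatMap (λ m → map (m *ᵐ_) q) p

  expand : Expr X → Poly
  expand (var x)  = monomial 1ᵈ (x ∷ [])
  expand (con e)  = monomial (toDyadic e) []
  expand (s ⊕ᴱ t) = expand s ++ expand t
  expand (s ⊛ᴱ t) = expand s *ᵖ expand t

  insert : Monomial → Poly → Poly
  insert m [] = m ∷ []
  insert (d , v) ((e , w) ∷ p) with List.≡-dec _≟_ v w
  ... | yes _ = (d +ᵈ e , w) ∷ p
  ... | no _  = (e , w) ∷ insert (d , v) p

  collect : Poly → Poly
  collect = foldr insert []

  -- In the monomial  d · x w  this applies the rule  xy = yx + q  to the first adjacent pair  x y  that has one.
  reorder : Dyadic → X → Word → Poly
  reorder d x []      = monomial d (x ∷ [])
  reorder d x (y ∷ v) with commute x y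
  ... | just (q , _) = (d , y ∷ x ∷ v) ∷ (monomial d [] *ᵖ expand q *ᵖ monomial 1ᵈ v)
  ... | nothing      = monomial 1ᵈ (x ∷ []) *ᵖ reorder d y v

  rewriteStep : Poly → Poly
  rewriteStep = concatMap λ { (d , []) → monomial d [] ; (d , x ∷ w) → reorder d x w }

  rewriteN : ℕ → Poly → Poly
  rewriteN zero    p = p
  rewriteN (suc n) p = rewriteN n (collect (rewriteStep p))

  -- Enough rounds for the products checked below; only completeness, not soundness, depends on it.
  fuel : ℕ
  fuel = 16

  normalise : Expr X → Poly
  normalise (var x)  = expand (var x)
  normalise (con e)  = expand (con e)
  normalise (s ⊕ᴱ t) = collect (normalise s ++ normalise t)
  normalise (s ⊛ᴱ t) = rewriteN fuel (normalise s *ᵖ normalise t)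

  Vanishes : Poly → Set
  Vanishes = All λ { (dyadic p n _ , _) → p ≡ n }

  vanishes? : Decidable Vanishes
  vanishes? = all? λ { (dyadic p n _ , _) → p ℕ.≟ n }

  ⟦⟧ᵖ-++ : ∀ p q → ⟦ p ++ q ⟧ᵖ ≈ ⟦ p ⟧ᵖ ⊕ ⟦ q ⟧ᵖ
  ⟦⟧ᵖ-++ []      q = sym (⊕-idˡ _)
  ⟦⟧ᵖ-++ (m ∷ p) q = trans (⊕-cong refl (⟦⟧ᵖ-++ p q)) (sym (⊕-assoc _ _ _))

  ⟦⟧ʷ-++ : ∀ v w → ⟦ v ++ w ⟧ʷ ≈ ⟦ v ⟧ʷ ⊛ ⟦ w ⟧ʷ
  ⟦⟧ʷ-++ []      w = sym (⊛-idˡ _)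
  ⟦⟧ʷ-++ (x ∷ v) w = trans (⊛-cong refl (⟦⟧ʷ-++ v w)) (sym (⊛-assoc _ _ _))

  ⟦⟧ᵐ-* : ∀ m m′ → ⟦ m *ᵐ m′ ⟧ᵐ ≈ ⟦ m ⟧ᵐ ⊛ ⟦ m′ ⟧ᵐ
  ⟦⟧ᵐ-* (d , v) (e , w) =
    trans (⊛-cong (sc-cong (⟦⟧ᵈ-homo-* d e)) (⟦⟧ʷ-++ v w)) (sym (sc-interchange _ _ _ _))

  ⟦⟧ᵖ-map-*ᵐ : ∀ m q → ⟦ map (m *ᵐ_) q ⟧ᵖ ≈ ⟦ m ⟧ᵐ ⊛ ⟦ q ⟧ᵖ
  ⟦⟧ᵖ-map-*ᵐ m []       = sym (zeroʳ _)
  ⟦⟧ᵖ-map-*ᵐ m (m′ ∷ q) = trans (⊕-cong (⟦⟧ᵐ-* m m′) (⟦⟧ᵖ-map-*ᵐ m q)) (sym (distribˡ _ _ _))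

  ⟦⟧ᵖ-* : ∀ p q → ⟦ p *ᵖ q ⟧ᵖ ≈ ⟦ p ⟧ᵖ ⊛ ⟦ q ⟧ᵖ
  ⟦⟧ᵖ-* []      q = sym (zeroˡ _)
  ⟦⟧ᵖ-* (m ∷ p) q = begin
    ⟦ map (m *ᵐ_) q ++ p *ᵖ q ⟧ᵖ         ≈⟨ ⟦⟧ᵖ-++ (map (m *ᵐ_) q) (p *ᵖ q) ⟩
    ⟦ map (m *ᵐ_) q ⟧ᵖ ⊕ ⟦ p *ᵖ q ⟧ᵖ    ≈⟨ ⊕-cong (⟦⟧ᵖ-map-*ᵐ m q) (⟦⟧ᵖ-* p q) ⟩
    ⟦ m ⟧ᵐ ⊛ ⟦ q ⟧ᵖ ⊕ ⟦ p ⟧ᵖ ⊛ ⟦ q ⟧ᵖ    ≈⟨ distribʳ _ _ _ ⟨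
    (⟦ m ⟧ᵐ ⊕ ⟦ p ⟧ᵖ) ⊛ ⟦ q ⟧ᵖ            ∎

  ⟦⟧ᵖ-monomial : ∀ d w → ⟦ monomial d w ⟧ᵖ ≈ ⟦ d , w ⟧ᵐ
  ⟦⟧ᵖ-monomial d w = +-identityʳ ⟦ d , w ⟧ᵐ

  ⟦⟧ᵐ-1ᵈ : ∀ w → ⟦ 1ᵈ , w ⟧ᵐ ≈ ⟦ w ⟧ʷ
  ⟦⟧ᵐ-1ᵈ w = trans (⊛-cong (sc-cong ⟦⟧ᵈ-1) refl) (⊛-idˡ _)

  expand-sound : ∀ t → ⟦ expand t ⟧ᵖ ≈ ⟦ t ⟧ᴱ
  expand-sound (var x)  = trans (⟦⟧ᵖ-monomial 1ᵈ (x ∷ [])) (trans (⟦⟧ᵐ-1ᵈ (x ∷ [])) (⊛-idʳ _))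
  expand-sound (con e)  = trans (⟦⟧ᵖ-monomial (toDyadic e) []) (trans (⊛-idʳ _) (sc-cong (toDyadic-sound e)))
  expand-sound (s ⊕ᴱ t) = trans (⟦⟧ᵖ-++ (expand s) (expand t)) (⊕-cong (expand-sound s) (expand-sound t))
  expand-sound (s ⊛ᴱ t) = trans (⟦⟧ᵖ-* (expand s) (expand t)) (⊛-cong (expand-sound s) (expand-sound t))

  insert-sound : ∀ m p → ⟦ insert m p ⟧ᵖ ≈ ⟦ m ⟧ᵐ ⊕ ⟦ p ⟧ᵖ
  insert-sound m [] = refl
  insert-sound (d , v) ((e , w) ∷ p) with List.≡-dec _≟_ v w
  ... | yes ≡.refl = trans (⊕-cong like-terms refl) (⊕-assoc _ _ _)
    where
    like-terms : ⟦ d +ᵈ e , v ⟧ᵐ ≈ ⟦ d , v ⟧ᵐ ⊕ ⟦ e , v ⟧ᵐ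
    like-terms = trans (⊛-cong (trans (sc-cong (⟦⟧ᵈ-homo-+ d e)) (sc-+ _ _)) refl) (distribʳ _ _ _)
  ... | no _ = begin
    ⟦ e , w ⟧ᵐ ⊕ ⟦ insert (d , v) p ⟧ᵖ        ≈⟨ ⊕-cong refl (insert-sound (d , v) p) ⟩
    ⟦ e , w ⟧ᵐ ⊕ (⟦ d , v ⟧ᵐ ⊕ ⟦ p ⟧ᵖ)        ≈⟨ ⊕-assoc _ _ _ ⟨
    ⟦ e , w ⟧ᵐ ⊕ ⟦ d , v ⟧ᵐ ⊕ ⟦ p ⟧ᵖ          ≈⟨ ⊕-cong (⊕-comm _ _) refl ⟩
    ⟦ d , v ⟧ᵐ ⊕ ⟦ e , w ⟧ᵐ ⊕ ⟦ p ⟧ᵖ          ≈⟨ ⊕-assoc _ _ _ ⟩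
    ⟦ d , v ⟧ᵐ ⊕ (⟦ e , w ⟧ᵐ ⊕ ⟦ p ⟧ᵖ)        ∎

  collect-sound : ∀ p → ⟦ collect p ⟧ᵖ ≈ ⟦ p ⟧ᵖ
  collect-sound []      = refl
  collect-sound (m ∷ p) = trans (insert-sound m (collect p)) (⊕-cong refl (collect-sound p))

  reorder-sound : ∀ d x w → ⟦ reorder d x w ⟧ᵖ ≈ ⟦ d , x ∷ w ⟧ᵐ
  reorder-sound d x []      = ⟦⟧ᵖ-monomial d (x ∷ [])
  reorder-sound d x (y ∷ v) with commute x y
  ... | just (q , xy≈yx+q) = begin
    ⟦ d , y ∷ x ∷ v ⟧ᵐ ⊕ ⟦ monomial d [] *ᵖ expand q *ᵖ monomial 1ᵈ v ⟧ᵖ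
      ≈⟨ ⊕-cong refl correction ⟩
    sc ⟦ d ⟧ᵈ ⊛ (gen y ⊛ (gen x ⊛ ⟦ v ⟧ʷ)) ⊕ sc ⟦ d ⟧ᵈ ⊛ (⟦ q ⟧ᴱ ⊛ ⟦ v ⟧ʷ)
      ≈⟨ distribˡ _ _ _ ⟨
    sc ⟦ d ⟧ᵈ ⊛ (gen y ⊛ (gen x ⊛ ⟦ v ⟧ʷ) ⊕ ⟦ q ⟧ᴱ ⊛ ⟦ v ⟧ʷ)
      ≈⟨ ⊛-cong refl (trans (⊕-cong (sym (⊛-assoc _ _ _)) refl) (sym (distribʳ _ _ _))) ⟩
    sc ⟦ d ⟧ᵈ ⊛ ((gen y ⊛ gen x ⊕ ⟦ q ⟧ᴱ) ⊛ ⟦ v ⟧ʷ)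
      ≈⟨ ⊛-cong refl (trans (⊛-cong (sym xy≈yx+q) refl) (⊛-assoc _ _ _)) ⟩
    ⟦ d , x ∷ y ∷ v ⟧ᵐ ∎
    where
    correction : ⟦ monomial d [] *ᵖ expand q *ᵖ monomial 1ᵈ v ⟧ᵖ ≈ sc ⟦ d ⟧ᵈ ⊛ (⟦ q ⟧ᴱ ⊛ ⟦ v ⟧ʷ)
    correction = begin
      ⟦ monomial d [] *ᵖ expand q *ᵖ monomial 1ᵈ v ⟧ᵖ
        ≈⟨ ⟦⟧ᵖ-* (monomial d [] *ᵖ expand q) _ ⟩
      ⟦ monomial d [] *ᵖ expand q ⟧ᵖ ⊛ ⟦ monomial 1ᵈ v ⟧ᵖ
        ≈⟨ ⊛-cong (⟦⟧ᵖ-* (monomial d []) (expand q)) (trans (⟦⟧ᵖ-monomial 1ᵈ v) (⟦⟧ᵐ-1ᵈ v)) ⟩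
      ⟦ monomial d [] ⟧ᵖ ⊛ ⟦ expand q ⟧ᵖ ⊛ ⟦ v ⟧ʷ
        ≈⟨ ⊛-cong (⊛-cong (trans (⟦⟧ᵖ-monomial d []) (⊛-idʳ _)) (expand-sound q)) refl ⟩
      sc ⟦ d ⟧ᵈ ⊛ ⟦ q ⟧ᴱ ⊛ ⟦ v ⟧ʷ
        ≈⟨ ⊛-assoc _ _ _ ⟩
      sc ⟦ d ⟧ᵈ ⊛ (⟦ q ⟧ᴱ ⊛ ⟦ v ⟧ʷ) ∎
  ... | nothing = begin
    ⟦ monomial 1ᵈ (x ∷ []) *ᵖ reorder d y v ⟧ᵖ
      ≈⟨ ⟦⟧ᵖ-* (monomial 1ᵈ (x ∷ [])) (reorder d y v) ⟩
    ⟦ monomial 1ᵈ (x ∷ []) ⟧ᵖ ⊛ ⟦ reorder d y v ⟧ᵖ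
      ≈⟨ ⊛-cong (expand-sound (var x)) (reorder-sound d y v) ⟩
    gen x ⊛ ⟦ d , y ∷ v ⟧ᵐ
      ≈⟨ sc-commute _ _ _ ⟨
    ⟦ d , x ∷ y ∷ v ⟧ᵐ ∎

  rewriteStep-sound : ∀ p → ⟦ rewriteStep p ⟧ᵖ ≈ ⟦ p ⟧ᵖ
  rewriteStep-sound []            = refl
  rewriteStep-sound ((d , []) ∷ p) =
    trans (⟦⟧ᵖ-++ (monomial d []) (rewriteStep p)) (⊕-cong (⟦⟧ᵖ-monomial d []) (rewriteStep-sound p))
  rewriteStep-sound ((d , x ∷ w) ∷ p) =
    trans (⟦⟧ᵖ-++ (reorder d x w) (rewriteStep p)) (⊕-cong (reorder-sound d x w) (rewriteStep-sound p))

  rewriteN-sound : ∀ n p → ⟦ rewriteN n p ⟧ᵖ ≈ ⟦ p ⟧ᵖ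
  rewriteN-sound zero    p = refl
  rewriteN-sound (suc n) p =
    trans (rewriteN-sound n _) (trans (collect-sound (rewriteStep p)) (rewriteStep-sound p))

  normalise-sound : ∀ t → ⟦ normalise t ⟧ᵖ ≈ ⟦ t ⟧ᴱ
  normalise-sound (var x)  = expand-sound (var x)
  normalise-sound (con e)  = expand-sound (con e)
  normalise-sound (s ⊕ᴱ t) =
    trans (collect-sound (normalise s ++ normalise t))
          (trans (⟦⟧ᵖ-++ (normalise s) (normalise t)) (⊕-cong (normalise-sound s) (normalise-sound t)))
  normalise-sound (s ⊛ᴱ t) =
    trans (rewriteN-sound fuel (normalise s *ᵖ normalise t))
          (trans (⟦⟧ᵖ-* (normalise s) (normalise t)) (⊛-cong (normalise-sound s) (normalise-sound t)))

  ⟦⟧ᵖ-vanishes : ∀ {p} → Vanishes p → ⟦ p ⟧ᵖ ≈ sc 0ₛ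
  ⟦⟧ᵖ-vanishes []                                          = refl
  ⟦⟧ᵖ-vanishes {(dyadic p _ k , w) ∷ _} (≡.refl ∷ vanishes) =
    trans (⊕-cong (trans (⊛-cong (sc-cong (⟦⟧ᵈ-zero p k)) refl) (zeroˡ _)) (⟦⟧ᵖ-vanishes vanishes)) (⊕-idˡ _)

  ≈-by-normalisation : ∀ s t → {True (vanishes? (normalise (s ⊖ᴱ t)))} → ⟦ s ⟧ᴱ ≈ ⟦ t ⟧ᴱ
  ≈-by-normalisation s t {vanishes} = x∙y⁻¹≈ε⇒x≈y ⟦ s ⟧ᴱ ⟦ t ⟧ᴱ (begin
    ⟦ s ⊖ᴱ t ⟧ᴱ               ≈⟨ normalise-sound (s ⊖ᴱ t) ⟨
    ⟦ normalise (s ⊖ᴱ t) ⟧ᵖ   ≈⟨ ⟦⟧ᵖ-vanishes (toWitness vanishes) ⟩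
    sc 0ₛ                     ∎)

module HahnToSl2⊗Sl2 {c ℓ} (K : CommutativeRing c ℓ) (half : CommutativeRing.Carrier K)
  (half+half≈1 : CommutativeRing._≈_ K (CommutativeRing._+_ K half half) (CommutativeRing.1# K)) where
  open Alg K half
  open Expressions K half
  open CommutativeRing K using () renaming (0# to 0ₛ)
  open PresentedRing K half TRel using (⊛-swap-by-commutator; ⊛-swap-by-commutator′; [,]-congˡ)

  _≟ˢˡ_ : DecidableEquality SlGen
  E ≟ˢˡ E = yes ≡.refl
  F ≟ˢˡ F = yes ≡.refl
  H ≟ˢˡ H = yes ≡.refl
  E ≟ˢˡ F = no λ ()
  E ≟ˢˡ H = no λ ()
  F ≟ˢˡ E = no λ ()
  F ≟ˢˡ H = no λ ()
  H ≟ˢˡ E = no λ ()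
  H ≟ˢˡ F = no λ ()

  _≟ᵀ_ : DecidableEquality TGen
  L x ≟ᵀ L y = map′ (≡.cong L) (λ { ≡.refl → ≡.refl }) (x ≟ˢˡ y)
  R x ≟ᵀ R y = map′ (≡.cong R) (λ { ≡.refl → ≡.refl }) (x ≟ˢˡ y)
  L _ ≟ᵀ R _ = no λ ()
  R _ ≟ᵀ L _ = no λ ()

  twoˢ fourˢ quarterˢ eighthˢ : ScalarExpr
  twoˢ     = 1ˢ +ˢ 1ˢ
  fourˢ    = twoˢ +ˢ twoˢ
  quarterˢ = ½ˢ *ˢ ½ˢ
  eighthˢ  = quarterˢ *ˢ ½ˢ

  -- The defining relations of U(sl₂) ⊗ U(sl₂), oriented towards the PBW order  E < F < H,  left factor first.
  commute : (x y : TGen) → Maybe (Commutation TRel x y)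
  commute (L F) (L E) = just (-ˢ 1ˢ ·ᴱ var (L H) , ⊛-swap-by-commutator′ (rel (left EF)))
  commute (L H) (L E) = just (twoˢ ·ᴱ var (L E) , ⊛-swap-by-commutator (rel (left HE)))
  commute (L H) (L F) = just (-ˢ twoˢ ·ᴱ var (L F) , ⊛-swap-by-commutator (rel (left HF)))
  commute (R F) (R E) = just (-ˢ 1ˢ ·ᴱ var (R H) , ⊛-swap-by-commutator′ (rel (right EF)))
  commute (R H) (R E) = just (twoˢ ·ᴱ var (R E) , ⊛-swap-by-commutator (rel (right HE)))
  commute (R H) (R F) = just (-ˢ twoˢ ·ᴱ var (R F) , ⊛-swap-by-commutator (rel (right HF)))
  commute (R x) (L y) = just (-ˢ 1ˢ ·ᴱ con 0ˢ , ⊛-swap-by-commutator′ (rel (comm y x)))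
  commute _     _     = nothing

  open Normalisation K half half+half≈1 _≟ᵀ_ TRel commute using (≈-by-normalisation)

  _⊗1ᴱ 1⊗ᴱ_ Δᴱ : Expr SlGen → Expr TGen
  _⊗1ᴱ = substᴱ (var ∘ L)
  1⊗ᴱ_ = substᴱ (var ∘ R)
  Δᴱ   = substᴱ λ x → var (L x) ⊕ᴱ var (R x)

  Λᴱ : Expr SlGen
  Λᴱ = var E ⊛ᴱ var F ⊕ᴱ var F ⊛ᴱ var E ⊕ᴱ ½ˢ ·ᴱ (var H ⊛ᴱ var H)

  ♮ᴱ : HGen → Expr TGen
  ♮ᴱ A = quarterˢ ·ᴱ (var H ⊗1ᴱ ⊖ᴱ 1⊗ᴱ var H)
  ♮ᴱ B = ½ˢ ·ᴱ Δᴱ Λᴱ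
  ♮ᴱ C = var E ⊗1ᴱ ⊛ᴱ 1⊗ᴱ var F ⊖ᴱ var F ⊗1ᴱ ⊛ᴱ 1⊗ᴱ var E

  ♮αᴱ ♮βᴱ : Expr TGen
  ♮αᴱ = ½ˢ ·ᴱ (Λᴱ ⊗1ᴱ ⊕ᴱ 1⊗ᴱ Λᴱ) ⊕ᴱ eighthˢ ·ᴱ (Δᴱ (var H) ⊛ᴱ Δᴱ (var H))
  ♮βᴱ = ½ˢ ·ᴱ ((Λᴱ ⊗1ᴱ ⊖ᴱ 1⊗ᴱ Λᴱ) ⊛ᴱ Δᴱ (var H))

  αᴱ βᴱ : Expr HGen
  αᴱ = [ var C , var A ]ᴱ ⊕ᴱ twoˢ ·ᴱ (var A ⊛ᴱ var A) ⊕ᴱ var B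
  βᴱ = [ var B , var C ]ᴱ ⊕ᴱ fourˢ ·ᴱ (var B ⊛ᴱ var A) ⊕ᴱ twoˢ ·ᴱ var C

  ♮ : Tm HGen → Tm TGen
  ♮ = subst (⟦_⟧ᴱ ∘ ♮ᴱ)

  ♮-α : ♮ α ∼ ♮α
  ♮-α = ≈-by-normalisation (substᴱ ♮ᴱ αᴱ) ♮αᴱ

  ♮-β : ♮ β ∼ ♮β
  ♮-β = ≈-by-normalisation (substᴱ ♮ᴱ βᴱ) ♮βᴱ

  ♮α-central : ∀ x → [ ♮α , ♮ (gen x) ] ∼ sc 0ₛ
  ♮α-central A = ≈-by-normalisation [ ♮αᴱ , ♮ᴱ A ]ᴱ (con 0ˢ)
  ♮α-central B = ≈-by-normalisation [ ♮αᴱ , ♮ᴱ B ]ᴱ (con 0ˢ)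
  ♮α-central C = ≈-by-normalisation [ ♮αᴱ , ♮ᴱ C ]ᴱ (con 0ˢ)

  ♮β-central : ∀ x → [ ♮β , ♮ (gen x) ] ∼ sc 0ₛ
  ♮β-central A = ≈-by-normalisation [ ♮βᴱ , ♮ᴱ A ]ᴱ (con 0ˢ)
  ♮β-central B = ≈-by-normalisation [ ♮βᴱ , ♮ᴱ B ]ᴱ (con 0ˢ)
  ♮β-central C = ≈-by-normalisation [ ♮βᴱ , ♮ᴱ C ]ᴱ (con 0ˢ)

  ♮-respects-HRel : ∀ {s t} → HRel s t → ♮ s ∼ ♮ t
  ♮-respects-HRel AB            = ≈-by-normalisation [ ♮ᴱ A , ♮ᴱ B ]ᴱ (♮ᴱ C)
  ♮-respects-HRel (α-central x) = trans ([,]-congˡ (♮ (gen x)) ♮-α) (♮α-central x)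
  ♮-respects-HRel (β-central x) = trans ([,]-congˡ (♮ (gen x)) ♮-β) (♮β-central x)

  open Substitution K half {RX = HRel} {RY = TRel} (⟦_⟧ᴱ ∘ ♮ᴱ)

  ♮-isHom : IsHom HRel TRel ♮
  ♮-isHom = subst-isHom ♮-respects-HRel

  ♮-unique : ∀ g → IsHom HRel TRel g → g (gen A) ∼ ♮A → g (gen B) ∼ ♮B → g (gen C) ∼ ♮C → ∀ t → ♮ t ∼ g t
  ♮-unique g g-hom gA gB gC = subst-unique g g-hom λ { A → sym gA ; B → sym gB ; C → sym gC }

theorem1p5 : ∀ {c ℓ} (K : CommutativeRing c ℓ) (half : CommutativeRing.Carrier K)
    → CommutativeRing._≈_ K (CommutativeRing._+_ K half half) (CommutativeRing.1# K)
    → let open Alg K half in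
      Σ (Tm HGen → Tm TGen) λ ♮ →
        (IsHom HRel TRel ♮ × ♮ (gen A) ∼ ♮A × ♮ (gen B) ∼ ♮B × ♮ (gen C) ∼ ♮C)
        × (∀ (g : Tm HGen → Tm TGen) → IsHom HRel TRel g
             → g (gen A) ∼ ♮A → g (gen B) ∼ ♮B → g (gen C) ∼ ♮C
             → ∀ t → ♮ t ∼ g t)
        × (♮ α ∼ ♮α × ♮ β ∼ ♮β)
theorem1p5 K half half+half≈1 = ♮ , (♮-isHom , refl , refl , refl) , ♮-unique , ♮-α , ♮-β
  where open HahnToSl2⊗Sl2 K half half+half≈1
        open Alg K half using (refl)
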